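{- In ABC, parallel composition is associative up to strong bisimilarity: for all ABC expressions $P,Q,R$, $(P|Q)|R\sim P|(Q|R)$.
   Context: ABC (Algebra of Broadcast Communication) is parametrised by sets $\mathcal A$ of agent identifiers, $\mathcal B$ of broadcast names and $\mathcal C$ of handshake communication names. Let $\bar{\mathcal C}=\{\bar c\mid c\in\mathcal C\}$, $H=\mathcal C\cup\bar{\mathcal C}$ (disjoint union), with $\bar{\bar c}=c$; $\mathcal B!=\{b!\mid b\in\mathcal B\}$, $\mathcal B?=\{b?\mid b\in\mathcal B\}$, and $Act=\mathcal B!\cup\mathcal B?\cup H\cup\{\tau\}$ (disjoint union). A relabelling is a function $f$ mapping $\mathcal B$ into $\mathcal B$ and $\mathcal C$ into $\mathcal C$, extended to $Act$ by $f(\bar c)=\overline{f(c)}$, $f(b\sharp)=f(b)\sharp$, $f(\tau)=\tau$. ABC expressions are generated by $0$, $\alpha.E$ ($\alpha\in Act$), $E+F$, $E|F$, $E\backslash c$ ($c\in H$), $E[f]$, and $A\in\mathcal A$; each $A\in\mathcal A$ has a defining equation $A\stackrel{def}{=}P$ with $P$ guarded. The transition relation is the least relation closed under the rules, with $\alpha,\ell\in Act$, $\eta\in H\cup\{\tau\}$, $c\in H$, $b\in\mathcal B$: (Act) $\alpha.E\xrightarrow{\alpha}E$; (Sum-l/r) $E\xrightarrow{\alpha}E'$ implies $E+F\xrightarrow{\alpha}E'$ and $F+E\xrightarrow{\alpha}E'$; (Par-l) $E\xrightarrow{\eta}E'$ implies $E|F\xrightarrow{\eta}E'|F$; (Par-r)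 $F\xrightarrow{\eta}F'$ implies $E|F\xrightarrow{\eta}E|F'$; (Comm) $E\xrightarrow{c}E'$, $F\xrightarrow{\bar c}F'$ imply $E|F\xrightarrow{\tau}E'|F'$; (Bro-l) $E\xrightarrow{b\sharp_1}E'$ ($\sharp_1\in\{!,?\}$) and $F$ has no $b?$-transition imply $E|F\xrightarrow{b\sharp_1}E'|F$; (Bro-r) symmetric; (Bro-c) $E\xrightarrow{b\sharp_1}E'$, $F\xrightarrow{b\sharp_2}F'$ imply $E|F\xrightarrow{b(\sharp_1\circ\sharp_2)}E'|F'$ where $!\circ?=?\circ!=!$, $?\circ?=?$, and $!\circ!$ is undefined; (Rel) $E\xrightarrow{\ell}E'$ implies $E[f]\xrightarrow{f(\ell)}E'[f]$; (Res) $E\xrightarrow{\ell}E'$, $\ell\notin\{c,\bar c\}$ imply $E\backslash c\xrightarrow{\ell}E'\backslash c$; (Rec) $P\xrightarrow{\ell}E'$ and $A\stackrel{def}{=}P$ imply $A\xrightarrow{\ell}E'$. $\sim$ denotes strong bisimilarity on the resulting labelled transition system. -}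

module Defs where

open import Data.Product using (Σ; _×_; _,_)
open import Relation.Nullary using (¬_)
open import Relation.Binary.PropositionalEquality using (_≡_)

-- ABC parametrised by agent identifiers 𝒜, broadcast names ℬ,
-- handshake communication names 𝒞.
module ABC (𝒜 ℬ 𝒞 : Set) where

  data H : Set where
    nm  : 𝒞 → H
    co  : 𝒞 → H

  bar : H → H
  bar (nm c) = co c
  bar (co c) = nm c

  data Sharp : Set where
    send recv : Sharp

  data _∘♯_≔_ : Sharp → Sharp → Sharp → Set where
    s∘r : send ∘♯ recv ≔ send
    r∘s : recv ∘♯ send ≔ send
    r∘r : recv ∘♯ recv ≔ recv

  data Act : Set where
    bc : ℬ → Sharp → Act
    hs : H → Act
    τ  : Act

  record Relabelling : Set where
    field
      fB : ℬ → ℬ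
      fC : 𝒞 → 𝒞

  open Relabelling public

  relH : Relabelling → H → H
  relH f (nm c) = nm (fC f c)
  relH f (co c) = co (fC f c)

  relAct : Relabelling → Act → Act
  relAct f (bc b ♯) = bc (fB f b) ♯
  relAct f (hs h)   = hs (relH f h)
  relAct f τ        = τ

  infixr 7 _∙_
  infixl 6 _⊕_
  infixl 5 _∣_

  data Expr : Set where
    𝟎     : Expr
    _∙_   : Act → Expr → Expr
    _⊕_   : Expr → Expr → Expr
    _∣_   : Expr → Expr → Expr
    _∖_   : Expr → H → Expr
    _[_]  : Expr → Relabelling → Expr
    agent : 𝒜 → Expr

  data Guarded : Expr → Set where
    g𝟎   : Guarded 𝟎
    g∙   : ∀ {α E} → Guarded (α ∙ E)
    g⊕   : ∀ {E F} → Guarded E → Guarded F → Guarded (E ⊕ F)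
    g∣   : ∀ {E F} → Guarded E → Guarded F → Guarded (E ∣ F)
    g∖   : ∀ {E c} → Guarded E → Guarded (E ∖ c)
    g[]  : ∀ {E f} → Guarded E → Guarded (E [ f ])

  data IsHτ : Act → Set where
    isH : ∀ h → IsHτ (hs h)
    isτ : IsHτ τ

  data Blocked (c : H) : Act → Set where
    blk   : Blocked c (hs c)
    blkco : Blocked c (hs (bar c))

  module Semantics (Δ : 𝒜 → Expr) where

    -- This is the stratum of the
    -- transition relation for labels b? (the set of expressions admitting
    -- a b?-transition), defined positively: it is exactly what the rules
    -- below derive for labels of the form b?.
    data CanRecv (b : ℬ) : Expr → Set where
      cAct  : ∀ {E} → CanRecv b (bc b recv ∙ E)
      cSumˡ : ∀ {E F} → CanRecv b E → CanRecv b (E ⊕ F)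
      cSumʳ : ∀ {E F} → CanRecv b F → CanRecv b (E ⊕ F)
      cParˡ : ∀ {E F} → CanRecv b E → CanRecv b (E ∣ F)
      cParʳ : ∀ {E F} → CanRecv b F → CanRecv b (E ∣ F)
      cRes  : ∀ {E c} → CanRecv b E → CanRecv b (E ∖ c)
      cRel  : ∀ {E f b'} → fB f b' ≡ b → CanRecv b' E → CanRecv b (E [ f ])
      cRec  : ∀ {A} → CanRecv b (Δ A) → CanRecv b (agent A)

    infix 4 _—[_]→_
    data _—[_]→_ : Expr → Act → Expr → Set where
      act   : ∀ {α E} → (α ∙ E) —[ α ]→ E
      sumˡ  : ∀ {E F α E'} → E —[ α ]→ E' → (E ⊕ F) —[ α ]→ E'
      sumʳ  : ∀ {E F α E'} → E —[ α ]→ E' → (F ⊕ E) —[ α ]→ E'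
      parˡ  : ∀ {E F η E'} → IsHτ η → E —[ η ]→ E' → (E ∣ F) —[ η ]→ (E' ∣ F)
      parʳ  : ∀ {E F η F'} → IsHτ η → F —[ η ]→ F' → (E ∣ F) —[ η ]→ (E ∣ F')
      comm  : ∀ {E F c E' F'} → E —[ hs c ]→ E' → F —[ hs (bar c) ]→ F'
            → (E ∣ F) —[ τ ]→ (E' ∣ F')
      broˡ  : ∀ {E F b ♯₁ E'} → E —[ bc b ♯₁ ]→ E' → ¬ CanRecv b F
            → (E ∣ F) —[ bc b ♯₁ ]→ (E' ∣ F)
      broʳ  : ∀ {E F b ♯₂ F'} → ¬ CanRecv b E → F —[ bc b ♯₂ ]→ F'
            → (E ∣ F) —[ bc b ♯₂ ]→ (E ∣ F')
      broc  : ∀ {E F b ♯₁ ♯₂ ♯ E' F'} → E —[ bc b ♯₁ ]→ E' → F —[ bc b ♯₂ ]→ F'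
            → ♯₁ ∘♯ ♯₂ ≔ ♯ → (E ∣ F) —[ bc b ♯ ]→ (E' ∣ F')
      rel   : ∀ {E f ℓ E'} → E —[ ℓ ]→ E' → (E [ f ]) —[ relAct f ℓ ]→ (E' [ f ])
      res   : ∀ {E c ℓ E'} → E —[ ℓ ]→ E' → ¬ Blocked c ℓ → (E ∖ c) —[ ℓ ]→ (E' ∖ c)
      rec   : ∀ {A ℓ E'} → Δ A —[ ℓ ]→ E' → agent A —[ ℓ ]→ E'

    record IsBisimulation (ℛ : Expr → Expr → Set) : Set where
      field
        forth : ∀ {P Q α P'} → ℛ P Q → P —[ α ]→ P'
              → Σ Expr (λ Q' → (Q —[ α ]→ Q') × ℛ P' Q')
        back  : ∀ {P Q α Q'} → ℛ P Q → Q —[ α ]→ Q'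
              → Σ Expr (λ P' → (P —[ α ]→ P') × ℛ P' Q')

    infix 4 _∼_
    _∼_ : Expr → Expr → Set₁
    P ∼ Q = Σ (Expr → Expr → Set) (λ ℛ → IsBisimulation ℛ × ℛ P Q)

-- The relation pairing (P ∣ Q) ∣ R with P ∣ (Q ∣ R) is a strong bisimulation:
-- every derivation of a transition on one side regroups into a derivation of the
-- same label on the other, and the residuals are again regrouped triples.
-- Handshake and τ moves regroup directly; broadcast moves additionally need that
-- the partial composition of ! and ? is associative, and that E ∣ F is unable to
-- receive b exactly when neither E nor F is.
module Submission where

open import Defs
open import Data.Product using (∃; _×_; _,_)
open import Relation.Nullary using (¬_)

module _ {𝒜 ℬ 𝒞 : Set} where
  open ABC 𝒜 ℬ 𝒞

  ∘♯-assocʳ : ∀ {a b d ab x} → a ∘♯ b ≔ ab → ab ∘♯ d ≔ x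
            → ∃ λ bd → b ∘♯ d ≔ bd × a ∘♯ bd ≔ x
  ∘♯-assocʳ s∘r s∘r = recv , r∘r , s∘r
  ∘♯-assocʳ r∘s s∘r = send , s∘r , r∘s
  ∘♯-assocʳ r∘r r∘s = send , r∘s , r∘s
  ∘♯-assocʳ r∘r r∘r = recv , r∘r , r∘r

  ∘♯-assocˡ : ∀ {a b d bd x} → b ∘♯ d ≔ bd → a ∘♯ bd ≔ x
            → ∃ λ ab → a ∘♯ b ≔ ab × ab ∘♯ d ≔ x
  ∘♯-assocˡ s∘r r∘s = send , r∘s , s∘r
  ∘♯-assocˡ r∘s r∘s = recv , r∘r , r∘s
  ∘♯-assocˡ r∘r s∘r = send , s∘r , s∘r
  ∘♯-assocˡ r∘r r∘r = recv , r∘r , r∘r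

  module _ (Δ : 𝒜 → Expr) where
    open Semantics Δ

    ¬CanRecv-∣ : ∀ {b E F} → ¬ CanRecv b E → ¬ CanRecv b F → ¬ CanRecv b (E ∣ F)
    ¬CanRecv-∣ ¬E ¬F (cParˡ e) = ¬E e
    ¬CanRecv-∣ ¬E ¬F (cParʳ f) = ¬F f

    ¬CanRecv-∣ˡ : ∀ {b E F} → ¬ CanRecv b (E ∣ F) → ¬ CanRecv b E
    ¬CanRecv-∣ˡ ¬EF e = ¬EF (cParˡ e)

    ¬CanRecv-∣ʳ : ∀ {b E F} → ¬ CanRecv b (E ∣ F) → ¬ CanRecv b F
    ¬CanRecv-∣ʳ ¬EF f = ¬EF (cParʳ f)

    data ∣-Assoc : Expr → Expr → Set where
      regroup : ∀ P Q R → ∣-Assoc ((P ∣ Q) ∣ R) (P ∣ (Q ∣ R))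

    ∣-assoc-forth : ∀ {P Q R α X} → (P ∣ Q) ∣ R —[ α ]→ X
                  → ∃ λ Y → P ∣ (Q ∣ R) —[ α ]→ Y × ∣-Assoc X Y
    ∣-assoc-forth (parˡ i (parˡ _ tP))       = _ , parˡ i tP , regroup _ _ _
    ∣-assoc-forth (parˡ i (parʳ _ tQ))       = _ , parʳ i (parˡ i tQ) , regroup _ _ _
    ∣-assoc-forth (parˡ _ (comm tP tQ))      = _ , comm tP (parˡ (isH _) tQ) , regroup _ _ _
    ∣-assoc-forth (parʳ i tR)                = _ , parʳ i (parʳ i tR) , regroup _ _ _
    ∣-assoc-forth (comm (parˡ _ tP) tR)      = _ , comm tP (parʳ (isH _) tR) , regroup _ _ _
    ∣-assoc-forth (comm (parʳ _ tQ) tR)      = _ , parʳ isτ (comm tQ tR) , regroup _ _ _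
    ∣-assoc-forth (broˡ (broˡ tP ¬Q) ¬R)     = _ , broˡ tP (¬CanRecv-∣ ¬Q ¬R) , regroup _ _ _
    ∣-assoc-forth (broˡ (broʳ ¬P tQ) ¬R)     = _ , broʳ ¬P (broˡ tQ ¬R) , regroup _ _ _
    ∣-assoc-forth (broˡ (broc tP tQ c) ¬R)   = _ , broc tP (broˡ tQ ¬R) c , regroup _ _ _
    ∣-assoc-forth (broʳ ¬PQ tR)              =
      _ , broʳ (¬CanRecv-∣ˡ ¬PQ) (broʳ (¬CanRecv-∣ʳ ¬PQ) tR) , regroup _ _ _
    ∣-assoc-forth (broc (broˡ tP ¬Q) tR c)   = _ , broc tP (broʳ ¬Q tR) c , regroup _ _ _
    ∣-assoc-forth (broc (broʳ ¬P tQ) tR c)   = _ , broʳ ¬P (broc tQ tR c) , regroup _ _ _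
    ∣-assoc-forth (broc (broc tP tQ c₁) tR c₂) =
      let _ , c₃ , c₄ = ∘♯-assocʳ c₁ c₂
      in _ , broc tP (broc tQ tR c₃) c₄ , regroup _ _ _

    ∣-assoc-back : ∀ {P Q R α Y} → P ∣ (Q ∣ R) —[ α ]→ Y
                 → ∃ λ X → (P ∣ Q) ∣ R —[ α ]→ X × ∣-Assoc X Y
    ∣-assoc-back (parˡ i tP)                 = _ , parˡ i (parˡ i tP) , regroup _ _ _
    ∣-assoc-back (parʳ i (parˡ _ tQ))        = _ , parˡ i (parʳ i tQ) , regroup _ _ _
    ∣-assoc-back (parʳ i (parʳ _ tR))        = _ , parʳ i tR , regroup _ _ _
    ∣-assoc-back (parʳ _ (comm tQ tR))       = _ , comm (parʳ (isH _) tQ) tR , regroup _ _ _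
    ∣-assoc-back (comm tP (parˡ _ tQ))       = _ , parˡ isτ (comm tP tQ) , regroup _ _ _
    ∣-assoc-back (comm tP (parʳ _ tR))       = _ , comm (parˡ (isH _) tP) tR , regroup _ _ _
    ∣-assoc-back (broˡ tP ¬QR)               =
      _ , broˡ (broˡ tP (¬CanRecv-∣ˡ ¬QR)) (¬CanRecv-∣ʳ ¬QR) , regroup _ _ _
    ∣-assoc-back (broʳ ¬P (broˡ tQ ¬R))      = _ , broˡ (broʳ ¬P tQ) ¬R , regroup _ _ _
    ∣-assoc-back (broʳ ¬P (broʳ ¬Q tR))      = _ , broʳ (¬CanRecv-∣ ¬P ¬Q) tR , regroup _ _ _
    ∣-assoc-back (broʳ ¬P (broc tQ tR c))    = _ , broc (broʳ ¬P tQ) tR c , regroup _ _ _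
    ∣-assoc-back (broc tP (broˡ tQ ¬R) c)    = _ , broˡ (broc tP tQ c) ¬R , regroup _ _ _
    ∣-assoc-back (broc tP (broʳ ¬Q tR) c)    = _ , broc (broˡ tP ¬Q) tR c , regroup _ _ _
    ∣-assoc-back (broc tP (broc tQ tR c₁) c₂) =
      let _ , c₃ , c₄ = ∘♯-assocˡ c₁ c₂
      in _ , broc (broc tP tQ c₃) tR c₄ , regroup _ _ _

    ∣-Assoc-isBisimulation : IsBisimulation ∣-Assoc
    IsBisimulation.forth ∣-Assoc-isBisimulation (regroup _ _ _) = ∣-assoc-forth
    IsBisimulation.back  ∣-Assoc-isBisimulation (regroup _ _ _) = ∣-assoc-back

theorem2 : {𝒜 ℬ 𝒞 : Set} → let open ABC 𝒜 ℬ 𝒞 in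
    (Δ : 𝒜 → Expr) → (∀ A → Guarded (Δ A)) →
    let open Semantics Δ in
    (P Q R : Expr) → ((P ∣ Q) ∣ R) ∼ (P ∣ (Q ∣ R))
theorem2 Δ _ P Q R = ∣-Assoc Δ , ∣-Assoc-isBisimulation Δ , regroup P Q R
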